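{- Let $j\in\mathbb{N}$ and suppose $n$ has prime factorisation $n=p_1^{a_1}\cdots p_k^{a_k}$. Then \[c_j(p_1^{a_1}\cdots p_k^{a_k})=(-1)^{1-j}\,j\;{}_{k+1}F_k\big(\{a_i+1\}_{i=1}^k,\,1-j;\ \{1\}_{i=1}^{k-1},\,2;\ 1\big).\]
   Context: $\mathbb{N}=\{1,2,\dots\}$. For $j\in\mathbb{N}$, $c_j(n)$ is the number of ordered tuples $(m_1,\dots,m_j)$ of integers $m_i\ge2$ with $m_1\cdots m_j=n$. The generalised hypergeometric series is ${}_kF_n(a_1,\dots,a_k;b_1,\dots,b_n;z)=\sum_{m=0}^\infty\frac{a_1^{\overline m}\cdots a_k^{\overline m}z^m}{b_1^{\overline m}\cdots b_n^{\overline m}m!}$, with rising factorial $a^{\overline m}=\prod_{i=0}^{m-1}(a+i)$, $a^{\overline 0}=1$; $\{x_i\}_{i=1}^k$ denotes the list of parameters $x_1,\dots,x_k$, and $\{1\}_{i=1}^{k-1}$ denotes $k-1$ parameters equal to $1$. -}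

module Defs where

open import Data.Nat as ℕ using (ℕ; zero; suc; _≤_; _≤?_)
open import Data.Nat.Properties as ℕP using ()
open import Data.Integer as ℤ using (ℤ; +_)
open import Data.Rational as ℚ using (ℚ; 0ℚ; 1ℚ; _+_; _*_; 1/_)
open import Data.Rational.Properties as ℚP using ()
open import Data.Rational.Base using (≢-nonZero)
open import Data.List as L using (List; []; _∷_; upTo; filter; length; concatMap; map)
open import Data.Vec as V using (Vec; []; _∷_)
open import Data.Vec.Relation.Unary.All using (All; all?)
open import Data.Product using (_×_)
open import Relation.Nullary using (yes; no)
open import Relation.Nullary.Decidable using (_×-dec_)
open import Relation.Binary.PropositionalEquality using (_≡_)

vprod : ∀ {j} → Vec ℕ j → ℕ
vprod = V.foldr _ ℕ._*_ 1

tuples : (j : ℕ) → List ℕ → List (Vec ℕ j)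
tuples zero    xs = [] ∷ []
tuples (suc j) xs = concatMap (λ x → map (x ∷_) (tuples j xs)) xs

IsFact : (n : ℕ) → ∀ {j} → Vec ℕ j → Set
IsFact n v = All (2 ≤_) v × vprod v ≡ n

-- c_j(n) counts the tuples satisfying IsFact.  For n ≥ 1 every m_i
-- divides n, hence m_i ≤ n, so enumerating entries in {0,…,n} is exhaustive.
c : (j n : ℕ) → ℕ
c j n = length (filter (λ v → all? (2 ≤?_) v ×-dec (vprod v ℕ.≟ n)) (tuples j (upTo (suc n))))

-- total division on ℚ (x / 0 := 0); only used with nonzero denominators here
_÷'_ : ℚ → ℚ → ℚ
p ÷' q with q ℚP.≟ 0ℚ
... | yes _  = 0ℚ
... | no q≢0 = p * (1/_ q {{≢-nonZero q≢0}})

_^ℚ_ : ℚ → ℕ → ℚ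
x ^ℚ zero  = 1ℚ
x ^ℚ suc m = x * (x ^ℚ m)

ℕtoℚ : ℕ → ℚ
ℕtoℚ n = (+ n) ℚ./ 1

rising : ℚ → ℕ → ℚ
rising a zero    = 1ℚ
rising a (suc m) = rising a m * (a + ℕtoℚ m)

factℚ : ℕ → ℚ
factℚ m = rising 1ℚ m

prodℚ : List ℚ → ℚ
prodℚ = L.foldr _*_ 1ℚ

sumℚ : List ℚ → ℚ
sumℚ = L.foldr _+_ 0ℚ

hypTerm : List ℚ → List ℚ → ℚ → ℕ → ℚ
hypTerm as bs z m =
  (prodℚ (map (λ a → rising a m) as) * (z ^ℚ m))
    ÷' (prodℚ (map (λ b → rising b m) bs) * factℚ m)

hypPartial : List ℚ → List ℚ → ℚ → ℕ → ℚ
hypPartial as bs z M = sumℚ (map (hypTerm as bs z) (upTo M))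

{-# OPTIONS --safe #-}
module Submission where

-- Write n = ∏ p_r ^ a_r, so that divisors of n are the ∏ p_r ^ e_r with e ≤ a.  Let τ_i(n) be the
-- number of ordered i-tuples of positive integers (1 allowed) with product n; it is multiplicative
-- with τ_(m+1)(p^x) = (x+1)^(m) / m!.  Splitting off the first entry of a tuple gives
-- c_(j+1)(n) = ∑_(1 < d ∣ n) c_j(n/d) and τ_(i+1)(n) = ∑_(d ∣ n) τ_i(n/d), hence by induction
-- c_j(n) = (Δ^j τ_•(n))(0) = ∑_i (-1)^(j-i) (j choose i) τ_i(n).  As (-1)^(j-i) (j choose i) i! =
-- (-1)^j (-j)^(i), (-j)^(m+1) = -j (1-j)^(m) and (m+1)! = 2^(m), the summand for i = m + 1 is
-- (-1)^(j-1) j times the m-th term of the hypergeometric series; the summand for i = 0 vanishes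
-- because n > 1, and the terms with m ≥ j vanish, so any M ≥ j gives the whole sum.

open import Algebra.Structures using (IsCommutativeSemiring)
open import Function using (_∘_)
open import Data.Nat.Base using (ℕ; zero; suc; _≤_; _<_; z≤n; s≤s; z<s; s<s)
open import Data.Vec.Base using (Vec; []; _∷_)
open import Data.Vec.Relation.Binary.Pointwise.Inductive using (Pointwise; []; _∷_)
open import Data.Fin.Base using (Fin)
import Data.Fin.Base as Fin
import Data.Nat.Properties as ℕ
import Data.Vec.Base as Vec
import Data.Vec.Relation.Binary.Pointwise.Inductive as Pointwise
open import Data.Nat.Primality using (Prime)
open import Function.Definitions using (Injective)
open import Relation.Binary.PropositionalEquality
  using (_≡_; _≢_; refl; sym; trans; cong; cong₂; subst; subst₂; module ≡-Reasoning)

infix 4 _≤ᵛ_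
_≤ᵛ_ : ∀ {k} → Vec ℕ k → Vec ℕ k → Set
_≤ᵛ_ = Pointwise _≤_

module FiniteSums {A : Set} (_+_ : A → A → A) (0# : A) where

  open import Data.List.Base using (List; []; _∷_; foldr; map)

  sumMap : {X : Set} → (X → A) → List X → A
  sumMap f xs = foldr _+_ 0# (map f xs)

  sumUpTo : ℕ → (ℕ → A) → A
  sumUpTo zero    f = 0#
  sumUpTo (suc N) f = f 0 + sumUpTo N (f ∘ suc)

  sumBox : ∀ {k} → Vec ℕ k → (Vec ℕ k → A) → A
  sumBox []      f = f []
  sumBox (B ∷ b) f = sumUpTo (suc B) (λ t → sumBox b (λ e → f (t ∷ e)))

  sumUpTo-cong : ∀ N {f g : ℕ → A} → (∀ x → x < N → f x ≡ g x) → sumUpTo N f ≡ sumUpTo N g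
  sumUpTo-cong zero    f≡g = refl
  sumUpTo-cong (suc N) f≡g = cong₂ _+_ (f≡g 0 z<s) (sumUpTo-cong N (λ x x<N → f≡g (suc x) (s<s x<N)))

  sumBox-cong : ∀ {k} (b : Vec ℕ k) {f g : Vec ℕ k → A} →
                (∀ e → e ≤ᵛ b → f e ≡ g e) → sumBox b f ≡ sumBox b g
  sumBox-cong []      f≡g = f≡g [] []
  sumBox-cong (B ∷ b) f≡g =
    sumUpTo-cong (suc B) (λ { t (s≤s t≤B) → sumBox-cong b (λ e e≤b → f≡g (t ∷ e) (t≤B ∷ e≤b)) })

  sumMap-cong : ∀ {X : Set} {f g : X → A} → (∀ x → f x ≡ g x) → ∀ xs → sumMap f xs ≡ sumMap g xs
  sumMap-cong f≡g []       = refl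
  sumMap-cong f≡g (x ∷ xs) = cong₂ _+_ (f≡g x) (sumMap-cong f≡g xs)

module SemiringSums {A : Set} {_+_ _*_ : A → A → A} {0# 1# : A}
            (isCommutativeSemiring : IsCommutativeSemiring _≡_ _+_ _*_ 0# 1#) where

  open IsCommutativeSemiring isCommutativeSemiring
    using (+-isCommutativeSemigroup; +-assoc; +-identityˡ; +-identityʳ; distribˡ; zeroʳ; *-comm)
  open import Algebra.Bundles using (CommutativeSemigroup)
  private
    +-commutativeSemigroup : CommutativeSemigroup _ _
    +-commutativeSemigroup = record { isCommutativeSemigroup = +-isCommutativeSemigroup }
  open import Algebra.Properties.CommutativeSemigroup +-commutativeSemigroup using (interchange)
  open import Data.List.Base using (List; []; _∷_; _++_; map; concatMap; applyUpTo)
  open import Data.Vec.Properties using (∷-injectiveˡ; ∷-injectiveʳ)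
  open import Data.Nat.Properties using (suc-injective)
  open FiniteSums _+_ 0# public

  sumUpTo-zero : ∀ N {f : ℕ → A} → (∀ x → x < N → f x ≡ 0#) → sumUpTo N f ≡ 0#
  sumUpTo-zero zero    f≡0 = refl
  sumUpTo-zero (suc N) f≡0 =
    trans (cong₂ _+_ (f≡0 0 z<s) (sumUpTo-zero N (λ x x<N → f≡0 (suc x) (s<s x<N)))) (+-identityˡ 0#)

  sumUpTo-+ : ∀ N (f g : ℕ → A) → sumUpTo N (λ x → f x + g x) ≡ sumUpTo N f + sumUpTo N g
  sumUpTo-+ zero    f g = sym (+-identityˡ 0#)
  sumUpTo-+ (suc N) f g =
    trans (cong ((f 0 + g 0) +_) (sumUpTo-+ N (f ∘ suc) (g ∘ suc))) (interchange _ _ _ _)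

  sumUpTo-*ˡ : ∀ N c (f : ℕ → A) → sumUpTo N (λ x → c * f x) ≡ c * sumUpTo N f
  sumUpTo-*ˡ zero    c f = sym (zeroʳ c)
  sumUpTo-*ˡ (suc N) c f = trans (cong ((c * f 0) +_) (sumUpTo-*ˡ N c (f ∘ suc))) (sym (distribˡ c _ _))

  sumUpTo-*ʳ : ∀ N c (f : ℕ → A) → sumUpTo N (λ x → f x * c) ≡ sumUpTo N f * c
  sumUpTo-*ʳ N c f =
    trans (sumUpTo-cong N (λ x _ → *-comm (f x) c)) (trans (sumUpTo-*ˡ N c f) (*-comm c _))

  sumUpTo-last : ∀ N (f : ℕ → A) → sumUpTo (suc N) f ≡ sumUpTo N f + f N
  sumUpTo-last zero    f = trans (+-identityʳ (f 0)) (sym (+-identityˡ (f 0)))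
  sumUpTo-last (suc N) f = trans (cong (f 0 +_) (sumUpTo-last N (f ∘ suc))) (sym (+-assoc _ _ _))

  sumUpTo-single : ∀ N y {f : ℕ → A} → y < N → (∀ x → x < N → x ≢ y → f x ≡ 0#) → sumUpTo N f ≡ f y
  sumUpTo-single (suc N) zero    {f} y<N f≡0 =
    trans (cong (f 0 +_) (sumUpTo-zero N (λ x x<N → f≡0 (suc x) (s<s x<N) λ ()))) (+-identityʳ (f 0))
  sumUpTo-single (suc N) (suc y) {f} (s<s y<N) f≡0 =
    trans (cong (_+ sumUpTo N (f ∘ suc)) (f≡0 0 z<s λ ()))
          (trans (+-identityˡ _)
                 (sumUpTo-single N y y<N (λ x x<N x≢y → f≡0 (suc x) (s<s x<N) (x≢y ∘ suc-injective))))

  sumBox-zero : ∀ {k} (b : Vec ℕ k) {f : Vec ℕ k → A} → (∀ e → e ≤ᵛ b → f e ≡ 0#) → sumBox b f ≡ 0#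
  sumBox-zero []      f≡0 = f≡0 [] []
  sumBox-zero (B ∷ b) f≡0 =
    sumUpTo-zero (suc B) (λ { t (s≤s t≤B) → sumBox-zero b (λ e e≤b → f≡0 (t ∷ e) (t≤B ∷ e≤b)) })

  sumBox-+ : ∀ {k} (b : Vec ℕ k) (f g : Vec ℕ k → A) → sumBox b (λ e → f e + g e) ≡ sumBox b f + sumBox b g
  sumBox-+ []      f g = refl
  sumBox-+ (B ∷ b) f g =
    trans (sumUpTo-cong (suc B) (λ t _ → sumBox-+ b (λ e → f (t ∷ e)) (λ e → g (t ∷ e))))
          (sumUpTo-+ (suc B) (λ t → sumBox b (λ e → f (t ∷ e))) (λ t → sumBox b (λ e → g (t ∷ e))))

  sumBox-*ˡ : ∀ {k} (b : Vec ℕ k) c (f : Vec ℕ k → A) → sumBox b (λ e → c * f e) ≡ c * sumBox b f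
  sumBox-*ˡ []      c f = refl
  sumBox-*ˡ (B ∷ b) c f =
    trans (sumUpTo-cong (suc B) (λ t _ → sumBox-*ˡ b c (λ e → f (t ∷ e))))
          (sumUpTo-*ˡ (suc B) c (λ t → sumBox b (λ e → f (t ∷ e))))

  sumBox-single : ∀ {k} (b e₀ : Vec ℕ k) {f : Vec ℕ k → A} → e₀ ≤ᵛ b →
                  (∀ e → e ≤ᵛ b → e ≢ e₀ → f e ≡ 0#) → sumBox b f ≡ f e₀
  sumBox-single []      []       []             f≡0 = refl
  sumBox-single (B ∷ b) (t₀ ∷ e₀) (t₀≤B ∷ e₀≤b) f≡0 =
    trans (sumUpTo-single (suc B) t₀ (s≤s t₀≤B) λ { t (s≤s t≤B) t≢t₀ →
             sumBox-zero b (λ e e≤b → f≡0 (t ∷ e) (t≤B ∷ e≤b) (t≢t₀ ∘ ∷-injectiveˡ)) })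
          (sumBox-single b e₀ e₀≤b (λ e e≤b e≢e₀ → f≡0 (t₀ ∷ e) (t₀≤B ∷ e≤b) (e≢e₀ ∘ ∷-injectiveʳ)))

  sumMap-zero : ∀ {X : Set} {f : X → A} → (∀ x → f x ≡ 0#) → ∀ xs → sumMap f xs ≡ 0#
  sumMap-zero f≡0 []       = refl
  sumMap-zero f≡0 (x ∷ xs) = trans (cong₂ _+_ (f≡0 x) (sumMap-zero f≡0 xs)) (+-identityˡ 0#)

  sumMap-*ˡ : ∀ {X : Set} c (f : X → A) xs → sumMap (λ x → c * f x) xs ≡ c * sumMap f xs
  sumMap-*ˡ c f []       = sym (zeroʳ c)
  sumMap-*ˡ c f (x ∷ xs) = trans (cong ((c * f x) +_) (sumMap-*ˡ c f xs)) (sym (distribˡ c _ _))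

  sumMap-++ : ∀ {X : Set} (f : X → A) xs ys → sumMap f (xs ++ ys) ≡ sumMap f xs + sumMap f ys
  sumMap-++ f []       ys = sym (+-identityˡ _)
  sumMap-++ f (x ∷ xs) ys = trans (cong (f x +_) (sumMap-++ f xs ys)) (sym (+-assoc (f x) _ _))

  sumMap-map : ∀ {X Y : Set} (f : Y → A) (g : X → Y) xs → sumMap f (map g xs) ≡ sumMap (f ∘ g) xs
  sumMap-map f g []       = refl
  sumMap-map f g (x ∷ xs) = cong (f (g x) +_) (sumMap-map f g xs)

  sumMap-concatMap : ∀ {X Y : Set} (f : Y → A) (g : X → List Y) xs →
                     sumMap f (concatMap g xs) ≡ sumMap (λ x → sumMap f (g x)) xs
  sumMap-concatMap f g []       = refl
  sumMap-concatMap f g (x ∷ xs) =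
    trans (sumMap-++ f (g x) (concatMap g xs)) (cong (sumMap f (g x) +_) (sumMap-concatMap f g xs))

  sumMap-applyUpTo : ∀ (f : ℕ → A) (g : ℕ → ℕ) N → sumMap f (applyUpTo g N) ≡ sumUpTo N (f ∘ g)
  sumMap-applyUpTo f g zero    = refl
  sumMap-applyUpTo f g (suc N) = cong (f (g 0) +_) (sumMap-applyUpTo f (g ∘ suc) N)

  sumMap-sumBox : ∀ {X : Set} {k} (b : Vec ℕ k) (g : X → Vec ℕ k → A) xs →
                  sumMap (λ x → sumBox b (g x)) xs ≡ sumBox b (λ e → sumMap (λ x → g x e) xs)
  sumMap-sumBox b g []       = sym (sumBox-zero b (λ _ _ → refl))
  sumMap-sumBox b g (x ∷ xs) = trans (cong (sumBox b (g x) +_) (sumMap-sumBox b g xs)) (sym (sumBox-+ b _ _))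

module SumHomomorphism {A B : Set} {_+ᴬ_ : A → A → A} {0ᴬ : A} {_+ᴮ_ : B → B → B} {0ᴮ : B}
                       (h : A → B) (h-0 : h 0ᴬ ≡ 0ᴮ) (h-+ : ∀ x y → h (x +ᴬ y) ≡ h x +ᴮ h y) where

  private
    module SA = FiniteSums _+ᴬ_ 0ᴬ
    module SB = FiniteSums _+ᴮ_ 0ᴮ

  sumUpTo-hom : ∀ N (f : ℕ → A) → h (SA.sumUpTo N f) ≡ SB.sumUpTo N (h ∘ f)
  sumUpTo-hom zero    f = h-0
  sumUpTo-hom (suc N) f = trans (h-+ (f 0) _) (cong (h (f 0) +ᴮ_) (sumUpTo-hom N (f ∘ suc)))

  sumBox-hom : ∀ {k} (b : Vec ℕ k) (f : Vec ℕ k → A) → h (SA.sumBox b f) ≡ SB.sumBox b (h ∘ f)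
  sumBox-hom []      f = refl
  sumBox-hom (B ∷ b) f =
    trans (sumUpTo-hom (suc B) (λ t → SA.sumBox b (λ e → f (t ∷ e))))
          (SB.sumUpTo-cong (suc B) λ t _ → sumBox-hom b (λ e → f (t ∷ e)))

module PrimePowers where

  open import Data.Nat.Base using (_+_; _*_; _^_; _∸_; nonTrivial⇒≢1)
  open import Data.Nat.Divisibility
    using (_∣_; _∤_; divides; _∣?_; ∣1⇒≡1; m∣m*n; ∣m⇒∣m*n; *-cancelˡ-∣)
  open import Data.Nat.Primality using (Prime; euclidsLemma; prime⇒irreducible; prime⇒nonZero; prime⇒nonTrivial)
  open import Data.Nat.Coprimality using (Coprime; coprime-divisor)
  open import Data.Nat.Tactic.RingSolver using (solve-∀)
  import Data.Fin.Properties as Fin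
  open import Data.Vec.Base using (zipWith; replicate; tabulate)
  open import Data.Vec.Functional using (head; tail)
  import Data.List.Base as List
  import Data.List.Properties as List
  open import Data.Nat.ListAction using (product)
  open import Data.Product using (∃-syntax; _×_; _,_)
  open import Data.Sum using (inj₁; inj₂)
  open import Data.Empty using (⊥-elim)
  open import Relation.Nullary using (yes; no)

  prodPow : ∀ {k} → (Fin k → ℕ) → Vec ℕ k → ℕ
  prodPow p []      = 1
  prodPow p (x ∷ e) = head p ^ x * prodPow (tail p) e

  infixl 6 _∸ᵛ_
  _∸ᵛ_ : ∀ {k} → Vec ℕ k → Vec ℕ k → Vec ℕ k
  _∸ᵛ_ = zipWith _∸_

  zeros : ∀ k → Vec ℕ k
  zeros k = replicate k 0

  zeros-≤ᵛ : ∀ {k} (b : Vec ℕ k) → zeros k ≤ᵛ b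
  zeros-≤ᵛ []      = []
  zeros-≤ᵛ (x ∷ b) = z≤n ∷ zeros-≤ᵛ b

  ∸ᵛ-zeros : ∀ {k} (b : Vec ℕ k) → b ∸ᵛ zeros k ≡ b
  ∸ᵛ-zeros []      = refl
  ∸ᵛ-zeros (x ∷ b) = cong (x ∷_) (∸ᵛ-zeros b)

  ∸ᵛ-≤ᵛ : ∀ {k} (b e : Vec ℕ k) → b ∸ᵛ e ≤ᵛ b
  ∸ᵛ-≤ᵛ []      []      = []
  ∸ᵛ-≤ᵛ (x ∷ b) (y ∷ e) = ℕ.m∸n≤m x y ∷ ∸ᵛ-≤ᵛ b e

  prodPow-zeros : ∀ {k} (p : Fin k → ℕ) → prodPow p (zeros k) ≡ 1
  prodPow-zeros {zero}  p = refl
  prodPow-zeros {suc k} p = trans (ℕ.+-identityʳ _) (prodPow-zeros (tail p))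

  prodPow-nonZero : ∀ {k} (p : Fin k → ℕ) → (∀ i → p i ≢ 0) → ∀ e → prodPow p e ≢ 0
  prodPow-nonZero p p≢0 (x ∷ e) pe≡0 with ℕ.m*n≡0⇒m≡0∨n≡0 (head p ^ x) pe≡0
  ... | inj₁ p^x≡0 = p≢0 Fin.zero (ℕ.m^n≡0⇒m≡0 (head p) x p^x≡0)
  ... | inj₂ pe≡0′ = prodPow-nonZero (tail p) (p≢0 ∘ Fin.suc) e pe≡0′

  prodPow-∸ᵛ : ∀ {k} (p : Fin k → ℕ) {e b : Vec ℕ k} → e ≤ᵛ b →
               prodPow p b ≡ prodPow p e * prodPow p (b ∸ᵛ e)
  prodPow-∸ᵛ p []                          = refl
  prodPow-∸ᵛ p {y ∷ e} {B ∷ b} (y≤B ∷ e≤b) = begin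
    head p ^ B * prodPow (tail p) b
      ≡⟨ cong₂ _*_ (cong (head p ^_) (sym (ℕ.m+[n∸m]≡n y≤B))) (prodPow-∸ᵛ (tail p) e≤b) ⟩
    head p ^ (y + (B ∸ y)) * (prodPow (tail p) e * prodPow (tail p) (b ∸ᵛ e))
      ≡⟨ cong (_* _) (ℕ.^-distribˡ-+-* (head p) y (B ∸ y)) ⟩
    head p ^ y * head p ^ (B ∸ y) * (prodPow (tail p) e * prodPow (tail p) (b ∸ᵛ e))
      ≡⟨ interchange (head p ^ y) (head p ^ (B ∸ y)) (prodPow (tail p) e) (prodPow (tail p) (b ∸ᵛ e)) ⟩
    head p ^ y * prodPow (tail p) e * (head p ^ (B ∸ y) * prodPow (tail p) (b ∸ᵛ e))  ∎
    where
    open ≡-Reasoning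
    interchange : ∀ a b c d → a * b * (c * d) ≡ a * c * (b * d)
    interchange = solve-∀

  prodPow-mono-∣ : ∀ {k} (p : Fin k → ℕ) {e b : Vec ℕ k} → e ≤ᵛ b → prodPow p e ∣ prodPow p b
  prodPow-mono-∣ p {e} {b} e≤b =
    divides (prodPow p (b ∸ᵛ e)) (trans (prodPow-∸ᵛ p e≤b) (ℕ.*-comm (prodPow p e) _))

  prime≢1 : ∀ {q} → Prime q → q ≢ 1
  prime≢1 q-prime = nonTrivial⇒≢1 {{prime⇒nonTrivial q-prime}}

  prime∣prime^⇒≡ : ∀ {q r} → Prime q → Prime r → ∀ x → q ∣ r ^ x → q ≡ r
  prime∣prime^⇒≡ q-prime r-prime zero    q∣1 = ⊥-elim (prime≢1 q-prime (∣1⇒≡1 q∣1))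
  prime∣prime^⇒≡ {q} {r} q-prime r-prime (suc x) q∣r^x+1 with euclidsLemma r (r ^ x) q-prime q∣r^x+1
  ... | inj₂ q∣r^x = prime∣prime^⇒≡ q-prime r-prime x q∣r^x
  ... | inj₁ q∣r with prime⇒irreducible r-prime q∣r
  ...   | inj₁ q≡1 = ⊥-elim (prime≢1 q-prime q≡1)
  ...   | inj₂ q≡r = q≡r

  prime∤prodPow : ∀ {k q} (p : Fin k → ℕ) → Prime q → (∀ i → Prime (p i)) → (∀ i → q ≢ p i) →
                  ∀ e → q ∤ prodPow p e
  prime∤prodPow p q-prime p-prime q≢p []      q∣1 = prime≢1 q-prime (∣1⇒≡1 q∣1)
  prime∤prodPow p q-prime p-prime q≢p (x ∷ e) q∣pe
    with euclidsLemma (head p ^ x) (prodPow (tail p) e) q-prime q∣pe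
  ... | inj₁ q∣p^x = q≢p Fin.zero (prime∣prime^⇒≡ q-prime (p-prime Fin.zero) x q∣p^x)
  ... | inj₂ q∣pe′ = prime∤prodPow (tail p) q-prime (p-prime ∘ Fin.suc) (q≢p ∘ Fin.suc) e q∣pe′

  prime∤⇒coprime : ∀ {r x} → Prime r → r ∤ x → Coprime x r
  prime∤⇒coprime r-prime r∤x (d∣x , d∣r) with prime⇒irreducible r-prime d∣r
  ... | inj₁ d≡1 = d≡1
  ... | inj₂ refl = ⊥-elim (r∤x d∣x)

  prime^*-injective : ∀ {r R R′} → Prime r → r ∤ R → r ∤ R′ →
                      ∀ x y → r ^ x * R ≡ r ^ y * R′ → x ≡ y × R ≡ R′
  prime^*-injective {r} {R} {R′} r-prime r∤R r∤R′ zero zero eq =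
    refl , trans (sym (ℕ.*-identityˡ R)) (trans eq (ℕ.*-identityˡ R′))
  prime^*-injective {r} {R} {R′} r-prime r∤R r∤R′ (suc x) zero eq =
    ⊥-elim (r∤R′ (subst (r ∣_) (trans eq (ℕ.*-identityˡ R′)) (∣m⇒∣m*n R (m∣m*n (r ^ x)))))
  prime^*-injective {r} {R} {R′} r-prime r∤R r∤R′ zero (suc y) eq =
    ⊥-elim (r∤R (subst (r ∣_) (trans (sym eq) (ℕ.*-identityˡ R)) (∣m⇒∣m*n R′ (m∣m*n (r ^ y)))))
  prime^*-injective {r} {R} {R′} r-prime r∤R r∤R′ (suc x) (suc y) eq
    with prime^*-injective r-prime r∤R r∤R′ x y
           (ℕ.*-cancelˡ-≡ _ _ r {{prime⇒nonZero r-prime}}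
             (trans (sym (ℕ.*-assoc r (r ^ x) R)) (trans eq (ℕ.*-assoc r (r ^ y) R′))))
  ... | x≡y , R≡R′ = cong suc x≡y , R≡R′

  prodPow-injective : ∀ {k} (p : Fin k → ℕ) → (∀ i → Prime (p i)) → Injective _≡_ _≡_ p →
                      ∀ e e′ → prodPow p e ≡ prodPow p e′ → e ≡ e′
  prodPow-injective p p-prime p-inj []      []        eq = refl
  prodPow-injective p p-prime p-inj (x ∷ e) (x′ ∷ e′) eq
    with prime^*-injective (p-prime Fin.zero) (head∤ e) (head∤ e′) x x′ eq
    where
    head∤ : ∀ e → head p ∤ prodPow (tail p) e
    head∤ = prime∤prodPow (tail p) (p-prime Fin.zero) (p-prime ∘ Fin.suc) (λ i → Fin.0≢1+n ∘ p-inj)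
  ... | x≡x′ , pe≡pe′ =
    cong₂ _∷_ x≡x′ (prodPow-injective (tail p) (p-prime ∘ Fin.suc) (Fin.suc-injective ∘ p-inj) e e′ pe≡pe′)

  ∣prime^*⇒ : ∀ {r R} → Prime r → ∀ B x → x ∣ r ^ B * R →
              ∃[ y ] ∃[ x′ ] y ≤ B × x ≡ r ^ y * x′ × x′ ∣ R
  ∣prime^*⇒ {r} {R} r-prime zero    x x∣R =
    0 , x , z≤n , sym (ℕ.*-identityˡ x) , subst (x ∣_) (ℕ.*-identityˡ R) x∣R
  ∣prime^*⇒ {r} {R} r-prime (suc B) x x∣r^B+1R with r ∣? x
  ... | no r∤x with ∣prime^*⇒ r-prime B x x∣r^BR
    where
    x∣r^BR : x ∣ r ^ B * R
    x∣r^BR = coprime-divisor (prime∤⇒coprime r-prime r∤x) (subst (x ∣_) (ℕ.*-assoc r (r ^ B) R) x∣r^B+1R)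
  ...   | y , x′ , y≤B , x≡ , x′∣R = y , x′ , ℕ.m≤n⇒m≤1+n y≤B , x≡ , x′∣R
  ∣prime^*⇒ {r} {R} r-prime (suc B) x x∣r^B+1R | yes (divides z refl) with ∣prime^*⇒ r-prime B z z∣r^BR
    where
    z∣r^BR : z ∣ r ^ B * R
    z∣r^BR = *-cancelˡ-∣ r {{prime⇒nonZero r-prime}}
               (subst₂ _∣_ (ℕ.*-comm z r) (ℕ.*-assoc r (r ^ B) R) x∣r^B+1R)
  ...   | y , x′ , y≤B , refl , x′∣R = suc y , x′ , s≤s y≤B , rotate (r ^ y) x′ r , x′∣R
    where
    rotate : ∀ a b c → a * b * c ≡ c * a * b
    rotate = solve-∀

  product-allFin≡prodPow : ∀ {k} (p a : Fin k → ℕ) →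
                           product (List.map (λ i → p i ^ a i) (List.allFin k)) ≡ prodPow p (tabulate a)
  product-allFin≡prodPow p a =
    trans (cong product (List.map-tabulate (λ i → i) (λ i → p i ^ a i))) (product-tabulate p a)
    where
    product-tabulate : ∀ {k} (p a : Fin k → ℕ) →
                       product (List.tabulate (λ i → p i ^ a i)) ≡ prodPow p (tabulate a)
    product-tabulate {zero}  p a = refl
    product-tabulate {suc k} p a = cong (head p ^ head a *_) (product-tabulate (tail p) (tail a))

  ∣prodPow⇒ : ∀ {k} (p : Fin k → ℕ) → (∀ i → Prime (p i)) →
              ∀ b x → x ∣ prodPow p b → ∃[ e ] e ≤ᵛ b × prodPow p e ≡ x
  ∣prodPow⇒ p p-prime []      x x∣1 = [] , [] , sym (∣1⇒≡1 x∣1)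
  ∣prodPow⇒ p p-prime (B ∷ b) x x∣pb with ∣prime^*⇒ (p-prime Fin.zero) B x x∣pb
  ... | y , x′ , y≤B , x≡ , x′∣pb with ∣prodPow⇒ (tail p) (p-prime ∘ Fin.suc) b x′ x′∣pb
  ...   | e , e≤b , pe≡x′ = y ∷ e , y≤B ∷ e≤b , trans (cong (head p ^ y *_) pe≡x′) (sym x≡)

module Indicators where

  open import Data.Nat.Base using (_+_; _*_)
  open import Data.Bool.Base using (if_then_else_)
  open import Data.List.Base using ([]; _∷_; length; filter)
  open import Data.Empty using (⊥-elim)
  open import Relation.Nullary using (Dec; yes; no; does; ¬_)
  open import Relation.Nullary.Decidable using (_×-dec_)
  open FiniteSums _+_ 0 using (sumMap)

  𝟙 : {P : Set} → Dec P → ℕ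
  𝟙 P? = if does P? then 1 else 0

  𝟙-yes : {P : Set} (P? : Dec P) → P → 𝟙 P? ≡ 1
  𝟙-yes (yes _) _ = refl
  𝟙-yes (no ¬p) p = ⊥-elim (¬p p)

  𝟙-no : {P : Set} (P? : Dec P) → ¬ P → 𝟙 P? ≡ 0
  𝟙-no (yes p) ¬p = ⊥-elim (¬p p)
  𝟙-no (no _)  _  = refl

  𝟙-cong : {P Q : Set} (P? : Dec P) (Q? : Dec Q) → (P → Q) → (Q → P) → 𝟙 P? ≡ 𝟙 Q?
  𝟙-cong (yes p) Q? P→Q Q→P = sym (𝟙-yes Q? (P→Q p))
  𝟙-cong (no ¬p) Q? P→Q Q→P = sym (𝟙-no Q? (¬p ∘ Q→P))

  𝟙-× : {P Q : Set} (P? : Dec P) (Q? : Dec Q) → 𝟙 (P? ×-dec Q?) ≡ 𝟙 P? * 𝟙 Q?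
  𝟙-× (yes _) Q? = sym (ℕ.+-identityʳ (𝟙 Q?))
  𝟙-× (no _)  Q? = refl

  length-filter≡sum𝟙 : {X : Set} {P : X → Set} (P? : ∀ x → Dec (P x)) → ∀ xs →
                       length (filter P? xs) ≡ sumMap (λ x → 𝟙 (P? x)) xs
  length-filter≡sum𝟙 P? []       = refl
  length-filter≡sum𝟙 P? (x ∷ xs) with P? x
  ... | yes _ = cong suc (length-filter≡sum𝟙 P? xs)
  ... | no _  = length-filter≡sum𝟙 P? xs

module Counting (N : ℕ) where

  open import Data.Nat.Base using (_*_; ≢-nonZero)
  open import Data.Nat.Properties using (_≤?_; _≟_)
  open import Data.Nat.Divisibility using (_∤_; divides)
  open import Data.List.Base using (List; length; filter; upTo; concatMap; map)
  open import Data.Vec.Relation.Unary.All using (All; all?; _∷_)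
  open import Data.Product using (_×_; _,_)
  open import Relation.Nullary using (Dec)
  open import Relation.Nullary.Decidable using (_×-dec_)
  open import Defs using (vprod; tuples; IsFact)
  open Indicators
  open SemiringSums ℕ.+-*-isCommutativeSemiring

  entries : List ℕ
  entries = upTo (suc N)

  isFact? : ∀ t {j} (v : Vec ℕ j) → Dec (IsFact t v)
  isFact? t v = all? (2 ≤?_) v ×-dec (vprod v ≟ t)

  -- Defs.c j N is definitionally count j N.
  count : ℕ → ℕ → ℕ
  count j t = length (filter (isFact? t) (tuples j entries))

  IsTail : ℕ → ℕ → ∀ {j} → Vec ℕ j → Set
  IsTail x t v = All (2 ≤_) v × x * vprod v ≡ t

  isTail? : ∀ x t {j} (v : Vec ℕ j) → Dec (IsTail x t v)
  isTail? x t v = all? (2 ≤?_) v ×-dec (x * vprod v ≟ t)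

  countTails : ℕ → ℕ → ℕ → ℕ
  countTails j x t = sumMap (λ v → 𝟙 (isTail? x t v)) (tuples j entries)

  count≡sum𝟙 : ∀ j t → count j t ≡ sumMap (λ v → 𝟙 (isFact? t v)) (tuples j entries)
  count≡sum𝟙 j t = length-filter≡sum𝟙 (isFact? t) (tuples j entries)

  count-suc : ∀ j t → count (suc j) t ≡ sumMap (λ x → 𝟙 (2 ≤? x) * countTails j x t) entries
  count-suc j t = begin
    count (suc j) t
      ≡⟨ count≡sum𝟙 (suc j) t ⟩
    sumMap (λ v → 𝟙 (isFact? t v)) (concatMap (λ x → map (x ∷_) (tuples j entries)) entries)
      ≡⟨ sumMap-concatMap _ (λ x → map (x ∷_) (tuples j entries)) entries ⟩
    sumMap (λ x → sumMap (λ v → 𝟙 (isFact? t v)) (map (x ∷_) (tuples j entries))) entries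
      ≡⟨ sumMap-cong (λ x → sumMap-map _ (x ∷_) (tuples j entries)) entries ⟩
    sumMap (λ x → sumMap (λ v → 𝟙 (isFact? t (x ∷ v))) (tuples j entries)) entries
      ≡⟨ sumMap-cong (λ x → sumMap-cong (split x) (tuples j entries)) entries ⟩
    sumMap (λ x → sumMap (λ v → 𝟙 (2 ≤? x) * 𝟙 (isTail? x t v)) (tuples j entries)) entries
      ≡⟨ sumMap-cong (λ x → sumMap-*ˡ (𝟙 (2 ≤? x)) _ (tuples j entries)) entries ⟩
    sumMap (λ x → 𝟙 (2 ≤? x) * countTails j x t) entries  ∎
    where
    open ≡-Reasoning
    split : ∀ x {j} (v : Vec ℕ j) → 𝟙 (isFact? t (x ∷ v)) ≡ 𝟙 (2 ≤? x) * 𝟙 (isTail? x t v)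
    split x v = trans (𝟙-cong (isFact? t (x ∷ v)) ((2 ≤? x) ×-dec isTail? x t v)
                        (λ { (2≤x ∷ 2≤v , eq) → 2≤x , 2≤v , eq })
                        (λ { (2≤x , 2≤v , eq) → 2≤x ∷ 2≤v , eq }))
                      (𝟙-× (2 ≤? x) (isTail? x t v))

  countTails-cofactor : ∀ j x t t′ → x ≢ 0 → t ≡ x * t′ → countTails j x t ≡ count j t′
  countTails-cofactor j x t t′ x≢0 t≡xt′ =
    trans (sumMap-cong (λ v → 𝟙-cong (isTail? x t v) (isFact? t′ v)
                         (λ { (2≤v , eq) → 2≤v , ℕ.*-cancelˡ-≡ _ _ x {{≢-nonZero x≢0}} (trans eq t≡xt′) })
                         (λ { (2≤v , eq) → 2≤v , trans (cong (x *_) eq) (sym t≡xt′) }))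
                       (tuples j entries))
          (sym (count≡sum𝟙 j t′))

  countTails-∤ : ∀ j x t → x ∤ t → countTails j x t ≡ 0
  countTails-∤ j x t x∤t =
    sumMap-zero (λ v → 𝟙-no (isTail? x t v) λ { (_ , eq) →
                  x∤t (divides (vprod v) (trans (sym eq) (ℕ.*-comm x (vprod v)))) })
                (tuples j entries)

  sumMap-entries-single : ∀ y {f : ℕ → ℕ} → y ≤ N → (∀ x → x ≢ y → f x ≡ 0) → sumMap f entries ≡ f y
  sumMap-entries-single y {f} y≤N f≡0 =
    trans (sumMap-applyUpTo f (λ x → x) (suc N)) (sumUpTo-single (suc N) y (s≤s y≤N) (λ x _ → f≡0 x))

module CountingPrimePowers {k} (p : Fin k → ℕ) (p-prime : ∀ i → Prime (p i))
                           (p-injective : Injective _≡_ _≡_ p) (a : Vec ℕ k) where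

  open import Data.Nat.Base using (_*_; ≢-nonZero; ≢-nonZero⁻¹)
  open import Data.Nat.Properties using (_≤?_; _≟_)
  open import Data.Nat.Divisibility using (_∣?_; ∣⇒≤)
  open import Data.Nat.Primality using (prime⇒nonZero)
  open import Data.Vec.Properties using (≡-dec)
  open import Data.Product using (_,_)
  open import Relation.Nullary using (yes; no)
  open PrimePowers
  open Counting (prodPow p a) public
  open Indicators
  open SemiringSums ℕ.+-*-isCommutativeSemiring

  prodPow≢0 : ∀ e → prodPow p e ≢ 0
  prodPow≢0 = prodPow-nonZero p (λ i → ≢-nonZero⁻¹ (p i) {{prime⇒nonZero (p-prime i)}})

  prodPow≡1⇒zeros : ∀ e → prodPow p e ≡ 1 → e ≡ zeros k
  prodPow≡1⇒zeros e pe≡1 =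
    prodPow-injective p p-prime p-injective e (zeros k) (trans pe≡1 (sym (prodPow-zeros p)))

  count-zero-prodPow : ∀ b → count 0 (prodPow p b) ≡ 𝟙 (≡-dec _≟_ b (zeros k))
  count-zero-prodPow b =
    trans (count≡sum𝟙 0 (prodPow p b)) (trans (ℕ.+-identityʳ _)
          (𝟙-cong (1 ≟ prodPow p b) (≡-dec _≟_ b (zeros k))
            (prodPow≡1⇒zeros b ∘ sym) (λ { refl → sym (prodPow-zeros p) })))

  sumBox-select : ∀ b e₀ (f : Vec ℕ k → ℕ) → e₀ ≤ᵛ b →
                  sumBox b (λ e → 𝟙 (prodPow p e ≟ prodPow p e₀) * f e) ≡ f e₀
  sumBox-select b e₀ f e₀≤b =
    trans (sumBox-single b e₀ e₀≤b λ e _ e≢e₀ →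
             cong (_* f e) (𝟙-no (prodPow p e ≟ prodPow p e₀)
                                 (e≢e₀ ∘ prodPow-injective p p-prime p-injective e e₀)))
          (trans (cong (_* f e₀) (𝟙-yes (prodPow p e₀ ≟ prodPow p e₀) refl)) (ℕ.*-identityˡ (f e₀)))

  countTails-prodPow : ∀ j b x →
    countTails j x (prodPow p b) ≡ sumBox b (λ e → 𝟙 (prodPow p e ≟ x) * count j (prodPow p (b ∸ᵛ e)))
  countTails-prodPow j b x with x ∣? prodPow p b
  ... | no x∤pb =
    trans (countTails-∤ j x (prodPow p b) x∤pb)
          (sym (sumBox-zero b λ e e≤b →
                  cong (_* count j (prodPow p (b ∸ᵛ e)))
                       (𝟙-no (prodPow p e ≟ x) λ { refl → x∤pb (prodPow-mono-∣ p e≤b) })))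
  ... | yes x∣pb with ∣prodPow⇒ p p-prime b x x∣pb
  ...   | e₀ , e₀≤b , refl =
    trans (countTails-cofactor j (prodPow p e₀) (prodPow p b) _ (prodPow≢0 e₀) (prodPow-∸ᵛ p e₀≤b))
          (sym (sumBox-select b e₀ (λ e → count j (prodPow p (b ∸ᵛ e))) e₀≤b))

  prodPow≤prodPow-a : ∀ e → e ≤ᵛ a → prodPow p e ≤ prodPow p a
  prodPow≤prodPow-a e e≤a = ∣⇒≤ {{≢-nonZero (prodPow≢0 a)}} (prodPow-mono-∣ p e≤a)

  -- The first entry x of a tuple with product ∏ p^b is a divisor ∏ p^e, so the sum over x
  -- becomes a sum over exponent vectors e ≤ b.
  count-suc-prodPow : ∀ j b → b ≤ᵛ a →
    count (suc j) (prodPow p b) ≡ sumBox b (λ e → 𝟙 (2 ≤? prodPow p e) * count j (prodPow p (b ∸ᵛ e)))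
  count-suc-prodPow j b b≤a = begin
    count (suc j) (prodPow p b)
      ≡⟨ count-suc j (prodPow p b) ⟩
    sumMap (λ x → 𝟙 (2 ≤? x) * countTails j x (prodPow p b)) entries
      ≡⟨ sumMap-cong (λ x → trans (cong (𝟙 (2 ≤? x) *_) (countTails-prodPow j b x))
                                  (sym (sumBox-*ˡ b (𝟙 (2 ≤? x)) _))) entries ⟩
    sumMap (λ x → sumBox b (λ e → 𝟙 (2 ≤? x) * (𝟙 (prodPow p e ≟ x) * W e))) entries
      ≡⟨ sumMap-sumBox b (λ x e → 𝟙 (2 ≤? x) * (𝟙 (prodPow p e ≟ x) * W e)) entries ⟩
    sumBox b (λ e → sumMap (λ x → 𝟙 (2 ≤? x) * (𝟙 (prodPow p e ≟ x) * W e)) entries)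
      ≡⟨ sumBox-cong b (λ e e≤b → select e (Pointwise.trans ℕ.≤-trans e≤b b≤a)) ⟩
    sumBox b (λ e → 𝟙 (2 ≤? prodPow p e) * W e)  ∎
    where
    open ≡-Reasoning
    W : Vec ℕ k → ℕ
    W e = count j (prodPow p (b ∸ᵛ e))
    select : ∀ e → e ≤ᵛ a →
      sumMap (λ x → 𝟙 (2 ≤? x) * (𝟙 (prodPow p e ≟ x) * W e)) entries ≡ 𝟙 (2 ≤? prodPow p e) * W e
    select e e≤a =
      trans (sumMap-entries-single (prodPow p e) (prodPow≤prodPow-a e e≤a) λ x x≢pe →
               trans (cong (λ i → 𝟙 (2 ≤? x) * (i * W e)) (𝟙-no (prodPow p e ≟ x) (x≢pe ∘ sym)))
                     (ℕ.*-zeroʳ (𝟙 (2 ≤? x))))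
            (trans (cong (λ i → 𝟙 (2 ≤? prodPow p e) * (i * W e)) (𝟙-yes (prodPow p e ≟ prodPow p e) refl))
                   (cong (𝟙 (2 ≤? prodPow p e) *_) (ℕ.*-identityˡ (W e))))

module RationalArithmetic where

  open import Data.Maybe.Base using (just; nothing)
  open import Level using (0ℓ)
  open import Tactic.RingSolver using (solve-∀)
  import Tactic.RingSolver.Core.AlmostCommutativeRing as ACR
  import Data.Nat.Base as ℕ
  import Data.Integer.Base as ℤ
  import Data.Integer.Properties as ℤ
  open import Data.Integer.Base using (+_)
  open import Data.Rational.Base
    using (ℚ; mkℚ; 0ℚ; 1ℚ; _+_; _*_; -_; _-_; 1/_; _/_; Positive; NonNegative; ≢-nonZero)
  import Data.Rational.Properties as ℚ
  open import Data.Nat.Coprimality using (recompute; 1-coprimeTo) renaming (sym to coprime-sym)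
  open import Data.List.Base using ([]; _∷_; _++_; replicate)
  open import Data.Empty using (⊥-elim)
  open import Relation.Nullary using (yes; no)
  open import Defs using (ℕtoℚ; rising; _^ℚ_; _÷'_; prodℚ)

  ℚ-ring : ACR.AlmostCommutativeRing 0ℓ 0ℓ
  ℚ-ring = ACR.fromCommutativeRing ℚ.+-*-commutativeRing isZero
    where
    isZero : ∀ x → _
    isZero x with 0ℚ ℚ.≟ x
    ... | yes 0≡x = just 0≡x
    ... | no _    = nothing

  -- On the normal form n/1 of ℕtoℚ n, rational _+_ and _*_ compute by integer arithmetic.
  private
    ℕtoℚ-normal : ℕ → ℚ
    ℕtoℚ-normal n = mkℚ (+ n) 0 (recompute (coprime-sym (1-coprimeTo n)))

    ℕtoℚ≡normal : ∀ n → ℕtoℚ n ≡ ℕtoℚ-normal n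
    ℕtoℚ≡normal n = ℚ.normalize-coprime _

  ℕtoℚ-+ : ∀ m n → ℕtoℚ (m ℕ.+ n) ≡ ℕtoℚ m + ℕtoℚ n
  ℕtoℚ-+ m n =
    trans (cong₂ (λ x y → (x ℤ.+ y) / 1) (sym (ℤ.*-identityʳ (+ m))) (sym (ℤ.*-identityʳ (+ n))))
          (sym (cong₂ _+_ (ℕtoℚ≡normal m) (ℕtoℚ≡normal n)))

  ℕtoℚ-* : ∀ m n → ℕtoℚ (m ℕ.* n) ≡ ℕtoℚ m * ℕtoℚ n
  ℕtoℚ-* m n = trans (cong (_/ 1) (ℤ.pos-* m n)) (sym (cong₂ _*_ (ℕtoℚ≡normal m) (ℕtoℚ≡normal n)))

  ℕtoℚ-suc : ∀ n → ℕtoℚ (suc n) ≡ 1ℚ + ℕtoℚ n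
  ℕtoℚ-suc = ℕtoℚ-+ 1

  ℕtoℚ-nonNeg : ∀ n → NonNegative (ℕtoℚ n)
  ℕtoℚ-nonNeg n = ℚ.normalize-nonNeg n 1

  pos⇒≢0 : ∀ {q} → Positive q → q ≢ 0ℚ
  pos⇒≢0 q>0 refl = ℤ.Positive.pos q>0

  1^ℚ : ∀ m → 1ℚ ^ℚ m ≡ 1ℚ
  1^ℚ zero    = refl
  1^ℚ (suc m) = trans (ℚ.*-identityˡ (1ℚ ^ℚ m)) (1^ℚ m)

  prodℚ-++ : ∀ xs ys → prodℚ (xs ++ ys) ≡ prodℚ xs * prodℚ ys
  prodℚ-++ []       ys = sym (ℚ.*-identityˡ (prodℚ ys))
  prodℚ-++ (x ∷ xs) ys = trans (cong (x *_) (prodℚ-++ xs ys)) (sym (ℚ.*-assoc x (prodℚ xs) (prodℚ ys)))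

  prodℚ-replicate : ∀ r x → prodℚ (replicate r x) ≡ x ^ℚ r
  prodℚ-replicate zero    x = refl
  prodℚ-replicate (suc r) x = cong (x *_) (prodℚ-replicate r x)

  ÷'-nonZero : ∀ x y (y≢0 : y ≢ 0ℚ) → x ÷' y ≡ x * (1/ y) {{≢-nonZero y≢0}}
  ÷'-nonZero x y y≢0 with y ℚ.≟ 0ℚ
  ... | yes y≡0 = ⊥-elim (y≢0 y≡0)
  ... | no _    = refl

  *-÷'-≡ : ∀ c x y z → y ≢ 0ℚ → c * x ≡ z * y → c * (x ÷' y) ≡ z
  *-÷'-≡ c x y z y≢0 cx≡zy = begin
    c * (x ÷' y)          ≡⟨ cong (c *_) (÷'-nonZero x y y≢0) ⟩
    c * (x * y⁻¹)         ≡⟨ sym (ℚ.*-assoc c x y⁻¹) ⟩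
    (c * x) * y⁻¹         ≡⟨ cong (_* y⁻¹) cx≡zy ⟩
    (z * y) * y⁻¹         ≡⟨ ℚ.*-assoc z y y⁻¹ ⟩
    z * (y * y⁻¹)         ≡⟨ cong (z *_) (ℚ.*-inverseʳ y {{≢-nonZero y≢0}}) ⟩
    z * 1ℚ                ≡⟨ ℚ.*-identityʳ z ⟩
    z                     ∎
    where
    open ≡-Reasoning
    y⁻¹ = (1/ y) {{≢-nonZero y≢0}}

  rising-sucˡ : ∀ x m → rising x (suc m) ≡ x * rising (x + 1ℚ) m
  rising-sucˡ x zero    = unit x
    where
    unit : ∀ x → 1ℚ * (x + 0ℚ) ≡ x * 1ℚ
    unit = solve-∀ ℚ-ring
  rising-sucˡ x (suc m) = begin
    rising x (suc m) * (x + ℕtoℚ (suc m))        ≡⟨ cong₂ (λ r n → r * (x + n)) (rising-sucˡ x m) (ℕtoℚ-suc m) ⟩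
    x * rising (x + 1ℚ) m * (x + (1ℚ + ℕtoℚ m))  ≡⟨ regroup x (rising (x + 1ℚ) m) (ℕtoℚ m) ⟩
    x * (rising (x + 1ℚ) m * ((x + 1ℚ) + ℕtoℚ m)) ∎
    where
    open ≡-Reasoning
    regroup : ∀ x r n → x * r * (x + (1ℚ + n)) ≡ x * (r * ((x + 1ℚ) + n))
    regroup = solve-∀ ℚ-ring

  rising-0 : ∀ m → rising 0ℚ (suc m) ≡ 0ℚ
  rising-0 m = trans (rising-sucˡ 0ℚ m) (ℚ.*-zeroˡ (rising (0ℚ + 1ℚ) m))

  rising-+1 : ∀ x m → rising (x + 1ℚ) (suc m) ≡ rising x (suc m) + rising (x + 1ℚ) m * (1ℚ + ℕtoℚ m)
  rising-+1 x m =
    trans (split x (rising (x + 1ℚ) m) (ℕtoℚ m))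
          (cong (_+ rising (x + 1ℚ) m * (1ℚ + ℕtoℚ m)) (sym (rising-sucˡ x m)))
    where
    split : ∀ x r n → r * ((x + 1ℚ) + n) ≡ x * r + r * (1ℚ + n)
    split = solve-∀ ℚ-ring

  rising-positive : ∀ x → Positive x → ∀ m → Positive (rising x m)
  rising-positive x x>0 zero    = _
  rising-positive x x>0 (suc m) =
    ℚ.pos*pos⇒pos (rising x m) {{rising-positive x x>0 m}} (x + ℕtoℚ m)
      {{ℚ.pos+nonNeg⇒pos x {{x>0}} (ℕtoℚ m) {{ℕtoℚ-nonNeg m}}}}

module RationalSums where

  open import Data.Rational.Base using (ℚ; 0ℚ; _+_; -_; _-_)
  import Data.Rational.Properties as ℚ
  open import Algebra.Structures using (IsCommutativeRing)
  open SemiringSums (IsCommutativeRing.isCommutativeSemiring ℚ.+-*-isCommutativeRing) public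
  open SumHomomorphism {_+ᴬ_ = _+_} {0ᴬ = 0ℚ} {_+ᴮ_ = _+_} {0ᴮ = 0ℚ} -_ refl ℚ.neg-distrib-+

  sumUpTo-minus : ∀ N (f g : ℕ → ℚ) → sumUpTo N (λ x → f x - g x) ≡ sumUpTo N f - sumUpTo N g
  sumUpTo-minus N f g = trans (sumUpTo-+ N f (-_ ∘ g)) (cong (sumUpTo N f +_) (sym (sumUpTo-hom N g)))

  sumBox-minus : ∀ {k} (b : Vec ℕ k) (f g : Vec ℕ k → ℚ) → sumBox b (λ e → f e - g e) ≡ sumBox b f - sumBox b g
  sumBox-minus b f g = trans (sumBox-+ b f (-_ ∘ g)) (cong (sumBox b f +_) (sym (sumBox-hom b g)))

module OrderedFactorisations where

  open import Tactic.RingSolver using (solve-∀)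

  import Data.Nat.Base as ℕ
  open import Data.Nat.Base using (_∸_)
  import Data.List.Base as List
  open import Data.Vec.Base using (tabulate)
  open import Data.Vec.Functional using (head; tail)
  open import Data.Nat.Properties using (_≟_)
  open import Data.Vec.Properties using (≡-dec)
  open import Data.Rational.Base using (ℚ; 0ℚ; 1ℚ; _+_; _*_)
  import Data.Rational.Properties as ℚ
  open import Defs using (ℕtoℚ; rising; factℚ; _^ℚ_; prodℚ)
  open PrimePowers using (_∸ᵛ_; zeros)
  open Indicators using (𝟙)
  open RationalArithmetic
  open RationalSums

  -- τ i b is the number of ordered i-tuples of positive integers with product ∏ p_r ^ b_r,
  -- for any distinct primes p_r; it is the product of the prime-power counts τᵖ i b_r.
  τᵖ : ℕ → ℕ → ℚ
  τᵖ zero    zero    = 1ℚ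
  τᵖ zero    (suc x) = 0ℚ
  τᵖ (suc i) x       = sumUpTo (suc x) (λ t → τᵖ i (x ∸ t))

  τ : ℕ → ∀ {k} → Vec ℕ k → ℚ
  τ i []      = 1ℚ
  τ i (x ∷ b) = τᵖ i x * τ i b

  τ-zero : ∀ {k} (b : Vec ℕ k) → τ 0 b ≡ ℕtoℚ (𝟙 (≡-dec _≟_ b (zeros k)))
  τ-zero []          = refl
  τ-zero (zero ∷ b)  = trans (ℚ.*-identityˡ (τ 0 b)) (τ-zero b)
  τ-zero (suc x ∷ b) = ℚ.*-zeroˡ (τ 0 b)

  sumBox-τ : ∀ i {k} (b : Vec ℕ k) → sumBox b (λ e → τ i (b ∸ᵛ e)) ≡ τ (suc i) b
  sumBox-τ i []      = refl
  sumBox-τ i (B ∷ b) =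
    trans (sumUpTo-cong (suc B) (λ t _ → trans (sumBox-*ˡ b (τᵖ i (B ∸ t)) (λ e → τ i (b ∸ᵛ e)))
                                               (cong (τᵖ i (B ∸ t) *_) (sumBox-τ i b))))
          (sumUpTo-*ʳ (suc B) (τ (suc i) b) (λ t → τᵖ i (B ∸ t)))

  τᵖ-1 : ∀ x → τᵖ 1 x ≡ 1ℚ
  τᵖ-1 zero    = refl
  τᵖ-1 (suc x) = trans (ℚ.+-identityˡ _) (τᵖ-1 x)

  hockey-stick : ∀ m x →
    sumUpTo (suc x) (λ t → rising (ℕtoℚ (suc (x ∸ t))) m * (1ℚ + ℕtoℚ m)) ≡ rising (ℕtoℚ (suc x)) (suc m)
  hockey-stick m zero =
    trans (ℚ.+-identityʳ (rising 1ℚ m * (1ℚ + ℕtoℚ m)))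
          (sym (trans (rising-+1 0ℚ m)
                      (trans (cong (_+ rising 1ℚ m * (1ℚ + ℕtoℚ m)) (rising-0 m)) (ℚ.+-identityˡ _))))
  hockey-stick m (suc x) = begin
    rising z m * m+1 + sumUpTo (suc x) (λ t → rising (ℕtoℚ (suc (x ∸ t))) m * m+1)
      ≡⟨ cong (rising z m * m+1 +_) (hockey-stick m x) ⟩
    rising z m * m+1 + rising y (suc m)
      ≡⟨ ℚ.+-comm (rising z m * m+1) (rising y (suc m)) ⟩
    rising y (suc m) + rising z m * m+1
      ≡⟨ cong (λ w → rising y (suc m) + rising w m * m+1) z≡y+1 ⟩
    rising y (suc m) + rising (y + 1ℚ) m * m+1
      ≡⟨ sym (rising-+1 y m) ⟩
    rising (y + 1ℚ) (suc m)
      ≡⟨ cong (λ w → rising w (suc m)) (sym z≡y+1) ⟩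
    rising z (suc m)  ∎
    where
    open ≡-Reasoning
    m+1 = 1ℚ + ℕtoℚ m
    y = ℕtoℚ (suc x)
    z = ℕtoℚ (suc (suc x))
    z≡y+1 : z ≡ y + 1ℚ
    z≡y+1 = trans (ℕtoℚ-suc (suc x)) (ℚ.+-comm 1ℚ y)

  τᵖ-closed : ∀ m x → τᵖ (suc m) x * factℚ m ≡ rising (ℕtoℚ (suc x)) m
  τᵖ-closed zero    x = cong (_* 1ℚ) (τᵖ-1 x)
  τᵖ-closed (suc m) x = begin
    τᵖ (suc (suc m)) x * (factℚ m * (1ℚ + ℕtoℚ m))
      ≡⟨ sym (sumUpTo-*ʳ (suc x) (factℚ m * (1ℚ + ℕtoℚ m)) (λ t → τᵖ (suc m) (x ∸ t))) ⟩
    sumUpTo (suc x) (λ t → τᵖ (suc m) (x ∸ t) * (factℚ m * (1ℚ + ℕtoℚ m)))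
      ≡⟨ sumUpTo-cong (suc x) (λ t _ → trans (sym (ℚ.*-assoc (τᵖ (suc m) (x ∸ t)) (factℚ m) (1ℚ + ℕtoℚ m)))
                                             (cong (_* (1ℚ + ℕtoℚ m)) (τᵖ-closed m (x ∸ t)))) ⟩
    sumUpTo (suc x) (λ t → rising (ℕtoℚ (suc (x ∸ t))) m * (1ℚ + ℕtoℚ m))
      ≡⟨ hockey-stick m x ⟩
    rising (ℕtoℚ (suc x)) (suc m)  ∎
    where open ≡-Reasoning

  τ-closed : ∀ m K (a : Fin K → ℕ) →
    prodℚ (List.tabulate (λ i → rising (ℕtoℚ (a i ℕ.+ 1)) m)) ≡ τ (suc m) (tabulate a) * factℚ m ^ℚ K
  τ-closed m zero    a = refl
  τ-closed m (suc K) a = begin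
    rising (ℕtoℚ (a₀ ℕ.+ 1)) m * prodℚ (List.tabulate (λ i → rising (ℕtoℚ (tail a i ℕ.+ 1)) m))
      ≡⟨ cong₂ _*_ (cong (λ x → rising (ℕtoℚ x) m) (ℕ.+-comm a₀ 1)) (τ-closed m K (tail a)) ⟩
    rising (ℕtoℚ (suc a₀)) m * (τ (suc m) (tabulate (tail a)) * factℚ m ^ℚ K)
      ≡⟨ cong (_* (τ (suc m) (tabulate (tail a)) * factℚ m ^ℚ K)) (sym (τᵖ-closed m a₀)) ⟩
    τᵖ (suc m) a₀ * factℚ m * (τ (suc m) (tabulate (tail a)) * factℚ m ^ℚ K)
      ≡⟨ interchange (τᵖ (suc m) a₀) (factℚ m) (τ (suc m) (tabulate (tail a))) (factℚ m ^ℚ K) ⟩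
    τᵖ (suc m) a₀ * τ (suc m) (tabulate (tail a)) * (factℚ m * factℚ m ^ℚ K)  ∎
    where
    open ≡-Reasoning
    a₀ = head a
    interchange : ∀ w x y z → w * x * (y * z) ≡ w * y * (x * z)
    interchange = solve-∀ ℚ-ring

  τ-zero-nonzero : ∀ {k} (b : Vec ℕ (suc k)) → 1 ≤ Vec.head b → τ 0 b ≡ 0ℚ
  τ-zero-nonzero (suc x ∷ b) _ = ℚ.*-zeroˡ (τ 0 b)

module ForwardDifferences where

  open import Tactic.RingSolver using (solve-∀)

  open import Data.Rational.Base using (ℚ; 0ℚ; 1ℚ; _+_; _*_; -_; _-_)
  import Data.Rational.Properties as ℚ
  open import Defs using (ℕtoℚ; rising; factℚ; _^ℚ_)
  open RationalArithmetic
  open RationalSums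

  Δ : ℕ → (ℕ → ℚ) → ℚ
  Δ zero    u = u 0
  Δ (suc j) u = Δ j (u ∘ suc) - Δ j u

  Δ-cong : ∀ j {u v : ℕ → ℚ} → (∀ i → u i ≡ v i) → Δ j u ≡ Δ j v
  Δ-cong zero    u≡v = u≡v 0
  Δ-cong (suc j) u≡v = cong₂ _-_ (Δ-cong j (u≡v ∘ suc)) (Δ-cong j u≡v)

  Δ-sumBox : ∀ j {k} (b : Vec ℕ k) (g : ℕ → Vec ℕ k → ℚ) →
             Δ j (λ i → sumBox b (g i)) ≡ sumBox b (λ e → Δ j (λ i → g i e))
  Δ-sumBox zero    b g = refl
  Δ-sumBox (suc j) b g =
    trans (cong₂ _-_ (Δ-sumBox j b (g ∘ suc)) (Δ-sumBox j b g))
          (sym (sumBox-minus b (λ e → Δ j (λ i → g (suc i) e)) (λ e → Δ j (λ i → g i e))))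

  -- diffCoeff j i = (-1)^(j-i) (j choose i), the coefficient of u i in Δ j u
  diffCoeff : ℕ → ℕ → ℚ
  diffCoeff zero    zero    = 1ℚ
  diffCoeff zero    (suc i) = 0ℚ
  diffCoeff (suc j) zero    = - diffCoeff j 0
  diffCoeff (suc j) (suc i) = diffCoeff j i - diffCoeff j (suc i)

  diffCoeff-vanish : ∀ j i → j < i → diffCoeff j i ≡ 0ℚ
  diffCoeff-vanish zero    (suc i) _         = refl
  diffCoeff-vanish (suc j) (suc i) (s<s j<i) =
    cong₂ _-_ (diffCoeff-vanish j i j<i) (diffCoeff-vanish j (suc i) (ℕ.m≤n⇒m≤1+n j<i))

  Δ≡sum : ∀ j M → j ≤ M → ∀ u → Δ j u ≡ sumUpTo (suc M) (λ i → diffCoeff j i * u i)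
  Δ≡sum zero    M       _         u =
    sym (trans (cong (1ℚ * u 0 +_) (sumUpTo-zero M (λ i _ → ℚ.*-zeroˡ (u (suc i)))))
               (trans (ℚ.+-identityʳ (1ℚ * u 0)) (ℚ.*-identityˡ (u 0))))
  Δ≡sum (suc j) (suc M) (s≤s j≤M) u = begin
    Δ j (u ∘ suc) - Δ j u
      ≡⟨ cong₂ _-_ (Δ≡sum j M j≤M (u ∘ suc)) (Δ≡sum j M j≤M u) ⟩
    A - (c 0 * u 0 + B)
      ≡⟨ cong (λ z → A - (c 0 * u 0 + z)) (sym B′≡B) ⟩
    A - (c 0 * u 0 + B′)
      ≡⟨ regroup A B′ (c 0) (u 0) ⟩
    (- c 0) * u 0 + (A - B′)
      ≡⟨ cong ((- c 0) * u 0 +_) (sym (sumUpTo-minus (suc M) (λ i → c i * v i) (λ i → c (suc i) * v i))) ⟩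
    (- c 0) * u 0 + sumUpTo (suc M) (λ i → c i * v i - c (suc i) * v i)
      ≡⟨ cong ((- c 0) * u 0 +_) (sumUpTo-cong (suc M) λ i _ → sym (*-distribʳ-minus (c i) (c (suc i)) (v i))) ⟩
    (- c 0) * u 0 + sumUpTo (suc M) (λ i → (c i - c (suc i)) * u (suc i))  ∎
    where
    open ≡-Reasoning
    c = diffCoeff j
    v = u ∘ suc
    A = sumUpTo (suc M) (λ i → c i * u (suc i))
    B = sumUpTo M (λ i → c (suc i) * u (suc i))
    B′ = sumUpTo (suc M) (λ i → c (suc i) * u (suc i))
    B′≡B : B′ ≡ B
    B′≡B = begin
      B′                                 ≡⟨ sumUpTo-last M (λ i → c (suc i) * u (suc i)) ⟩
      B + c (suc M) * u (suc M)          ≡⟨ cong (λ z → B + z * u (suc M)) (diffCoeff-vanish j (suc M) (s≤s j≤M)) ⟩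
      B + 0ℚ * u (suc M)                 ≡⟨ cong (B +_) (ℚ.*-zeroˡ (u (suc M))) ⟩
      B + 0ℚ                             ≡⟨ ℚ.+-identityʳ B ⟩
      B                                  ∎
    regroup : ∀ A B c u → A - (c * u + B) ≡ (- c) * u + (A - B)
    regroup = solve-∀ ℚ-ring
    *-distribʳ-minus : ∀ x y w → (x - y) * w ≡ x * w - y * w
    *-distribʳ-minus = solve-∀ ℚ-ring

  diffCoeff-rising : ∀ j i → diffCoeff j i * factℚ i ≡ (- 1ℚ) ^ℚ j * rising (- ℕtoℚ j) i
  diffCoeff-rising zero    zero    = refl
  diffCoeff-rising zero    (suc i) =
    trans (ℚ.*-zeroˡ (factℚ (suc i))) (sym (trans (ℚ.*-identityˡ (rising 0ℚ (suc i))) (rising-0 i)))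
  diffCoeff-rising (suc j) zero    =
    trans (negate (diffCoeff j 0)) (trans (cong -_ (diffCoeff-rising j 0)) (negate′ ((- 1ℚ) ^ℚ j)))
    where
    negate : ∀ x → (- x) * 1ℚ ≡ - (x * 1ℚ)
    negate = solve-∀ ℚ-ring
    negate′ : ∀ s → - (s * 1ℚ) ≡ ((- 1ℚ) * s) * 1ℚ
    negate′ = solve-∀ ℚ-ring
  diffCoeff-rising (suc j) (suc i) = begin
    (diffCoeff j i - diffCoeff j (suc i)) * (factℚ i * (1ℚ + I))
      ≡⟨ expand (diffCoeff j i) (diffCoeff j (suc i)) (factℚ i) I ⟩
    diffCoeff j i * factℚ i * (1ℚ + I) - diffCoeff j (suc i) * factℚ (suc i)
      ≡⟨ cong₂ (λ x y → x * (1ℚ + I) - y) (diffCoeff-rising j i) (diffCoeff-rising j (suc i)) ⟩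
    S * X * (1ℚ + I) - S * (X * (- J + I))
      ≡⟨ collect S X I J ⟩
    ((- 1ℚ) * S) * ((- (1ℚ + J)) * X)
      ≡⟨ cong (((- 1ℚ) * S) *_) (sym rising-−j−1) ⟩
    ((- 1ℚ) * S) * rising (- ℕtoℚ (suc j)) (suc i)  ∎
    where
    open ≡-Reasoning
    I = ℕtoℚ i
    J = ℕtoℚ j
    S = (- 1ℚ) ^ℚ j
    X = rising (- J) i
    cancel : ∀ J → - (1ℚ + J) + 1ℚ ≡ - J
    cancel = solve-∀ ℚ-ring
    rising-−j−1 : rising (- ℕtoℚ (suc j)) (suc i) ≡ (- (1ℚ + J)) * X
    rising-−j−1 = begin
      rising (- ℕtoℚ (suc j)) (suc i)         ≡⟨ cong (λ z → rising (- z) (suc i)) (ℕtoℚ-suc j) ⟩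
      rising (- (1ℚ + J)) (suc i)             ≡⟨ rising-sucˡ (- (1ℚ + J)) i ⟩
      (- (1ℚ + J)) * rising (- (1ℚ + J) + 1ℚ) i ≡⟨ cong (λ z → (- (1ℚ + J)) * rising z i) (cancel J) ⟩
      (- (1ℚ + J)) * X                        ∎
    expand : ∀ c₁ c₂ F I → (c₁ - c₂) * (F * (1ℚ + I)) ≡ c₁ * F * (1ℚ + I) - c₂ * (F * (1ℚ + I))
    expand = solve-∀ ℚ-ring
    collect : ∀ S X I J → S * X * (1ℚ + I) - S * (X * (- J + I)) ≡ ((- 1ℚ) * S) * ((- (1ℚ + J)) * X)
    collect = solve-∀ ℚ-ring

  diffCoeff-suc-rising : ∀ j m →
    diffCoeff (suc j) (suc m) * factℚ (suc m) ≡ (- 1ℚ) ^ℚ j * ℕtoℚ (suc j) * rising (1ℚ - ℕtoℚ (suc j)) m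
  diffCoeff-suc-rising j m = begin
    diffCoeff (suc j) (suc m) * factℚ (suc m)  ≡⟨ diffCoeff-rising (suc j) (suc m) ⟩
    (- 1ℚ) * S * rising (- J) (suc m)           ≡⟨ cong ((- 1ℚ) * S *_) (rising-sucˡ (- J) m) ⟩
    (- 1ℚ) * S * ((- J) * rising (- J + 1ℚ) m)  ≡⟨ cong (λ z → (- 1ℚ) * S * ((- J) * rising z m)) (ℚ.+-comm (- J) 1ℚ) ⟩
    (- 1ℚ) * S * ((- J) * rising (1ℚ - J) m)    ≡⟨ signs S J (rising (1ℚ - J) m) ⟩
    S * J * rising (1ℚ - J) m                   ∎
    where
    open ≡-Reasoning
    S = (- 1ℚ) ^ℚ j
    J = ℕtoℚ (suc j)
    signs : ∀ S J R → (- 1ℚ) * S * ((- J) * R) ≡ S * J * R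
    signs = solve-∀ ℚ-ring

module OrderedFactorisationCount {k} (p : Fin k → ℕ) (p-prime : ∀ i → Prime (p i))
                                 (p-injective : Injective _≡_ _≡_ p) (a : Vec ℕ k) where

  open import Tactic.RingSolver using (solve-∀)

  import Data.Nat.Base as ℕ
  open import Data.Nat.Properties using (_≤?_; _≟_)
  open import Data.Rational.Base using (ℚ; 0ℚ; 1ℚ; _+_; _*_; -_; _-_)
  import Data.Rational.Properties as ℚ
  open import Data.Empty using (⊥-elim)
  open import Defs using (ℕtoℚ)
  open PrimePowers
  open CountingPrimePowers p p-prime p-injective a
  open Indicators
  open RationalArithmetic
  open RationalSums
  open OrderedFactorisations
  open ForwardDifferences
  open SumHomomorphism {_+ᴬ_ = ℕ._+_} {0ᴬ = 0} {_+ᴮ_ = _+_} {0ᴮ = 0ℚ} ℕtoℚ refl ℕtoℚ-+ using (sumBox-hom)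

  𝟙[2≤] : ∀ m → m ≢ 0 → ℕtoℚ (𝟙 (2 ≤? m)) ≡ 1ℚ - ℕtoℚ (𝟙 (m ≟ 1))
  𝟙[2≤] zero          m≢0 = ⊥-elim (m≢0 refl)
  𝟙[2≤] (suc zero)    _   = refl
  𝟙[2≤] (suc (suc m)) _   = refl

  sumBox-Δτ : ∀ {r} (b : Vec ℕ r) j →
              sumBox b (λ e → Δ j (λ i → τ i (b ∸ᵛ e))) ≡ Δ j (λ i → τ (suc i) b)
  sumBox-Δτ b j = trans (sym (Δ-sumBox j b (λ i e → τ i (b ∸ᵛ e)))) (Δ-cong j (λ i → sumBox-τ i b))

  sumBox-𝟙[prodPow≟1] : ∀ b (f : Vec ℕ k → ℚ) →
                        sumBox b (λ e → ℕtoℚ (𝟙 (prodPow p e ≟ 1)) * f e) ≡ f (zeros k)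
  sumBox-𝟙[prodPow≟1] b f = begin
    sumBox b (λ e → ℕtoℚ (𝟙 (prodPow p e ≟ 1)) * f e)
      ≡⟨ sumBox-single b (zeros k) (zeros-≤ᵛ b) (λ e _ e≢0 →
           trans (cong (λ x → ℕtoℚ x * f e) (𝟙-no (prodPow p e ≟ 1) (e≢0 ∘ prodPow≡1⇒zeros e)))
                 (ℚ.*-zeroˡ (f e))) ⟩
    ℕtoℚ (𝟙 (prodPow p (zeros k) ≟ 1)) * f (zeros k)
      ≡⟨ cong (λ x → ℕtoℚ x * f (zeros k)) (𝟙-yes (prodPow p (zeros k) ≟ 1) (prodPow-zeros p)) ⟩
    1ℚ * f (zeros k)
      ≡⟨ ℚ.*-identityˡ (f (zeros k)) ⟩
    f (zeros k)  ∎
    where open ≡-Reasoning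

  -- Inclusion–exclusion over the entries equal to 1.
  count≡Δτ : ∀ j b → b ≤ᵛ a → ℕtoℚ (count j (prodPow p b)) ≡ Δ j (λ i → τ i b)
  count≡Δτ zero    b _   = trans (cong ℕtoℚ (count-zero-prodPow b)) (sym (τ-zero b))
  count≡Δτ (suc j) b b≤a = begin
    ℕtoℚ (count (suc j) (prodPow p b))
      ≡⟨ cong ℕtoℚ (count-suc-prodPow j b b≤a) ⟩
    ℕtoℚ (FiniteSums.sumBox ℕ._+_ 0 b (λ e → 𝟙 (2 ≤? prodPow p e) ℕ.* count j (prodPow p (b ∸ᵛ e))))
      ≡⟨ sumBox-hom b _ ⟩
    sumBox b (λ e → ℕtoℚ (𝟙 (2 ≤? prodPow p e) ℕ.* count j (prodPow p (b ∸ᵛ e))))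
      ≡⟨ sumBox-cong b (λ e _ → step e) ⟩
    sumBox b (λ e → G e - 𝟙[=1] e * G e)
      ≡⟨ sumBox-minus b G (λ e → 𝟙[=1] e * G e) ⟩
    sumBox b G - sumBox b (λ e → 𝟙[=1] e * G e)
      ≡⟨ cong₂ _-_ (sumBox-Δτ b j)
                   (trans (sumBox-𝟙[prodPow≟1] b G) (Δ-cong j (λ i → cong (τ i) (∸ᵛ-zeros b)))) ⟩
    Δ j (λ i → τ (suc i) b) - Δ j (λ i → τ i b)  ∎
    where
    open ≡-Reasoning
    G : Vec ℕ k → ℚ
    G e = Δ j (λ i → τ i (b ∸ᵛ e))
    𝟙[=1] : Vec ℕ k → ℚ
    𝟙[=1] e = ℕtoℚ (𝟙 (prodPow p e ≟ 1))
    step : ∀ e → ℕtoℚ (𝟙 (2 ≤? prodPow p e) ℕ.* count j (prodPow p (b ∸ᵛ e))) ≡ G e - 𝟙[=1] e * G e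
    step e = begin
      ℕtoℚ (𝟙 (2 ≤? prodPow p e) ℕ.* count j (prodPow p (b ∸ᵛ e)))
        ≡⟨ ℕtoℚ-* (𝟙 (2 ≤? prodPow p e)) (count j (prodPow p (b ∸ᵛ e))) ⟩
      ℕtoℚ (𝟙 (2 ≤? prodPow p e)) * ℕtoℚ (count j (prodPow p (b ∸ᵛ e)))
        ≡⟨ cong₂ _*_ (𝟙[2≤] (prodPow p e) (prodPow≢0 e))
                     (count≡Δτ j (b ∸ᵛ e) (Pointwise.trans ℕ.≤-trans (∸ᵛ-≤ᵛ b e) b≤a)) ⟩
      (1ℚ - 𝟙[=1] e) * G e
        ≡⟨ distrib (𝟙[=1] e) (G e) ⟩
      G e - 𝟙[=1] e * G e  ∎
      where
      distrib : ∀ y g → (1ℚ - y) * g ≡ g - y * g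
      distrib = solve-∀ ℚ-ring

module HypergeometricTerms where

  open import Data.List.Base using ([]; _∷_; map)
  open import Data.List.Relation.Unary.All using (All; []; _∷_)
  import Data.List.Relation.Unary.All.Properties as All
  open import Data.Rational.Base using (_*_; 1ℚ; Positive)
  import Data.Rational.Properties as ℚ
  open import Defs using (rising; factℚ; prodℚ)
  open RationalArithmetic using (rising-positive)

  prodℚ-positive : ∀ {xs} → All Positive xs → Positive (prodℚ xs)
  prodℚ-positive []         = _
  prodℚ-positive {x ∷ xs} (x>0 ∷ xs>0) = ℚ.pos*pos⇒pos x {{x>0}} (prodℚ xs) {{prodℚ-positive xs>0}}

  hypDenominator-positive : ∀ {bs} m → All Positive bs → Positive (prodℚ (map (λ b → rising b m) bs) * factℚ m)
  hypDenominator-positive {bs} m bs>0 =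
    ℚ.pos*pos⇒pos (prodℚ (map (λ b → rising b m) bs))
                  {{prodℚ-positive (All.gmap⁺ {f = λ b → rising b m} (λ {b} b>0 → rising-positive b b>0 m) bs>0)}}
                  (factℚ m) {{rising-positive 1ℚ _ m}}

module CountingSeries (j k : ℕ) (a : Fin (suc k) → ℕ) where

  open import Tactic.RingSolver using (solve-∀)
  import Data.Nat.Base as ℕ
  open import Data.List.Base using (List; []; _∷_; _++_; map; replicate; allFin; tabulate)
  import Data.List.Properties as List
  open import Data.List.Relation.Unary.All using (All; []; _∷_)
  import Data.List.Relation.Unary.All.Properties as All
  open import Data.Rational.Base using (ℚ; 0ℚ; 1ℚ; _+_; _*_; -_; _-_; Positive)
  import Data.Rational.Properties as ℚ
  open import Defs using (ℕtoℚ; rising; factℚ; _^ℚ_; prodℚ; hypTerm; hypPartial)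
  open RationalArithmetic
  open RationalSums
  open OrderedFactorisations
  open ForwardDifferences
  open HypergeometricTerms

  upper : List ℚ
  upper = map (λ i → ℕtoℚ (a i ℕ.+ 1)) (allFin (suc k)) ++ (1ℚ - ℕtoℚ (suc j)) ∷ []

  lower : List ℚ
  lower = replicate k 1ℚ ++ ℕtoℚ 2 ∷ []

  sign : ℚ
  sign = (- 1ℚ) ^ℚ j * ℕtoℚ (suc j)

  numerator : ∀ m → prodℚ (map (λ x → rising x m) upper) * 1ℚ ^ℚ m
                    ≡ τ (suc m) (Vec.tabulate a) * factℚ m ^ℚ suc k * (rising (1ℚ - ℕtoℚ (suc j)) m * 1ℚ)
  numerator m = begin
    prodℚ (map r upper) * 1ℚ ^ℚ m
      ≡⟨ trans (cong (prodℚ (map r upper) *_) (1^ℚ m)) (ℚ.*-identityʳ _) ⟩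
    prodℚ (map r upper)
      ≡⟨ cong prodℚ (List.map-++ r exponents (y ∷ [])) ⟩
    prodℚ (map r exponents ++ map r (y ∷ []))
      ≡⟨ prodℚ-++ (map r exponents) (map r (y ∷ [])) ⟩
    prodℚ (map r exponents) * (rising y m * 1ℚ)
      ≡⟨ cong (λ xs → prodℚ xs * (rising y m * 1ℚ))
              (trans (sym (List.map-∘ {g = r} {f = g} (allFin (suc k)))) (List.map-tabulate (λ i → i) (r ∘ g))) ⟩
    prodℚ (tabulate (λ i → rising (ℕtoℚ (a i ℕ.+ 1)) m)) * (rising y m * 1ℚ)
      ≡⟨ cong (_* (rising y m * 1ℚ)) (τ-closed m (suc k) a) ⟩
    τ (suc m) (Vec.tabulate a) * factℚ m ^ℚ suc k * (rising y m * 1ℚ)  ∎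
    where
    open ≡-Reasoning
    r : ℚ → ℚ
    r x = rising x m
    g : Fin (suc k) → ℚ
    g i = ℕtoℚ (a i ℕ.+ 1)
    exponents = map g (allFin (suc k))
    y = 1ℚ - ℕtoℚ (suc j)

  denominator : ∀ m → prodℚ (map (λ x → rising x m) lower) * factℚ m
                      ≡ factℚ m ^ℚ k * (factℚ (suc m) * 1ℚ) * factℚ m
  denominator m = begin
    prodℚ (map r lower) * factℚ m
      ≡⟨ cong (_* factℚ m) (trans (cong prodℚ (List.map-++ r (replicate k 1ℚ) (ℕtoℚ 2 ∷ [])))
                                  (prodℚ-++ (map r (replicate k 1ℚ)) (r (ℕtoℚ 2) ∷ []))) ⟩
    prodℚ (map r (replicate k 1ℚ)) * (rising (ℕtoℚ 2) m * 1ℚ) * factℚ m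
      ≡⟨ cong (λ x → x * (rising (ℕtoℚ 2) m * 1ℚ) * factℚ m)
              (trans (cong prodℚ (List.map-replicate r k 1ℚ)) (prodℚ-replicate k (factℚ m))) ⟩
    factℚ m ^ℚ k * (rising (ℕtoℚ 2) m * 1ℚ) * factℚ m
      ≡⟨ cong (λ x → factℚ m ^ℚ k * (x * 1ℚ) * factℚ m) rising-2 ⟩
    factℚ m ^ℚ k * (factℚ (suc m) * 1ℚ) * factℚ m  ∎
    where
    open ≡-Reasoning
    r : ℚ → ℚ
    r x = rising x m
    rising-2 : rising (ℕtoℚ 2) m ≡ factℚ (suc m)
    rising-2 = sym (trans (rising-sucˡ 1ℚ m) (ℚ.*-identityˡ (rising (ℕtoℚ 2) m)))

  lower-positive : All Positive lower
  lower-positive = All.++⁺ (All.replicate⁺ k _) (_ ∷ [])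

  diffCoeff-τ≡hypTerm : ∀ m →
    diffCoeff (suc j) (suc m) * τ (suc m) (Vec.tabulate a) ≡ sign * hypTerm upper lower 1ℚ m
  diffCoeff-τ≡hypTerm m =
    sym (*-÷'-≡ sign _ _ (c * D) (pos⇒≢0 (hypDenominator-positive m lower-positive)) (begin
      sign * (prodℚ (map (λ x → rising x m) upper) * 1ℚ ^ℚ m)
        ≡⟨ cong (sign *_) (numerator m) ⟩
      sign * (D * (F * Fᵏ) * (R * 1ℚ))
        ≡⟨ regroup sign D F Fᵏ R ⟩
      D * F * Fᵏ * (sign * R)
        ≡⟨ cong (D * F * Fᵏ *_) (sym (diffCoeff-suc-rising j m)) ⟩
      D * F * Fᵏ * (c * factℚ (suc m))
        ≡⟨ regroup′ c D F Fᵏ (factℚ (suc m)) ⟩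
      c * D * (Fᵏ * (factℚ (suc m) * 1ℚ) * F)
        ≡⟨ cong (c * D *_) (sym (denominator m)) ⟩
      c * D * (prodℚ (map (λ x → rising x m) lower) * factℚ m)  ∎))
    where
    open ≡-Reasoning
    c = diffCoeff (suc j) (suc m)
    D = τ (suc m) (Vec.tabulate a)
    F = factℚ m
    Fᵏ = factℚ m ^ℚ k
    R = rising (1ℚ - ℕtoℚ (suc j)) m
    regroup : ∀ s D F Fᵏ R → s * (D * (F * Fᵏ) * (R * 1ℚ)) ≡ D * F * Fᵏ * (s * R)
    regroup = solve-∀ ℚ-ring
    regroup′ : ∀ c D F Fᵏ F′ → D * F * Fᵏ * (c * F′) ≡ c * D * (Fᵏ * (F′ * 1ℚ) * F)
    regroup′ = solve-∀ ℚ-ring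

  Δτ≡hypPartial : 1 ≤ a Fin.zero → ∀ M → suc j ≤ M →
                  Δ (suc j) (λ i → τ i (Vec.tabulate a)) ≡ sign * hypPartial upper lower 1ℚ M
  Δτ≡hypPartial 1≤a₀ M j<M = begin
    Δ (suc j) (λ i → τ i a′)
      ≡⟨ Δ≡sum (suc j) M j<M (λ i → τ i a′) ⟩
    c 0 * τ 0 a′ + sumUpTo M (λ m → c (suc m) * τ (suc m) a′)
      ≡⟨ cong (_+ sumUpTo M (λ m → c (suc m) * τ (suc m) a′))
              (trans (cong (c 0 *_) (τ-zero-nonzero a′ 1≤a₀)) (ℚ.*-zeroʳ (c 0))) ⟩
    0ℚ + sumUpTo M (λ m → c (suc m) * τ (suc m) a′)
      ≡⟨ ℚ.+-identityˡ _ ⟩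
    sumUpTo M (λ m → c (suc m) * τ (suc m) a′)
      ≡⟨ sumUpTo-cong M (λ m _ → diffCoeff-τ≡hypTerm m) ⟩
    sumUpTo M (λ m → sign * hypTerm upper lower 1ℚ m)
      ≡⟨ sumUpTo-*ˡ M sign (hypTerm upper lower 1ℚ) ⟩
    sign * sumUpTo M (hypTerm upper lower 1ℚ)
      ≡⟨ cong (sign *_) (sym (sumMap-applyUpTo (hypTerm upper lower 1ℚ) (λ x → x) M)) ⟩
    sign * hypPartial upper lower 1ℚ M  ∎
    where
    open ≡-Reasoning
    a′ = Vec.tabulate a
    c = diffCoeff (suc j)

open import Defs
open import Data.Nat using (ℕ; _≤_; _+_; _∸_; _^_)
open import Data.Nat.Primality using (Prime)
open import Data.Fin using (Fin)
open import Data.List using (List; _∷_; []; _++_; map; replicate; allFin)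
open import Data.Nat.ListAction using (product)
open import Data.Rational using (ℚ; 1ℚ; _*_; _-_; -_)
open import Function.Definitions using (Injective)
open import Relation.Binary.PropositionalEquality using (_≡_)

theorem13 : (j : ℕ) → 1 ≤ j →
  (n k : ℕ) → 1 ≤ k → (p a : Fin k → ℕ) →
  (∀ i → Prime (p i)) → Injective _≡_ _≡_ p → (∀ i → 1 ≤ a i) →
  n ≡ product (map (λ i → p i ^ a i) (allFin k)) →
  ∀ M → j ≤ M →
  ℕtoℚ (c j n) ≡
    ((- 1ℚ) ^ℚ (j ∸ 1)) * ℕtoℚ j
      * hypPartial (map (λ i → ℕtoℚ (a i + 1)) (allFin k) ++ (1ℚ - ℕtoℚ j) ∷ [])
                   (replicate (k ∸ 1) 1ℚ ++ ℕtoℚ 2 ∷ [])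
                   1ℚ M
theorem13 (suc j) _ n (suc k) _ p a p-prime p-injective 1≤a n≡∏ M j<M = begin
  ℕtoℚ (c (suc j) n)
    ≡⟨ cong (λ n → ℕtoℚ (c (suc j) n)) (trans n≡∏ (product-allFin≡prodPow p a)) ⟩
  ℕtoℚ (count (suc j) (prodPow p (Vec.tabulate a)))
    ≡⟨ count≡Δτ (suc j) (Vec.tabulate a) (Pointwise.refl ℕ.≤-refl) ⟩
  Δ (suc j) (λ i → τ i (Vec.tabulate a))
    ≡⟨ Δτ≡hypPartial (1≤a Fin.zero) M j<M ⟩
  sign * hypPartial upper lower 1ℚ M  ∎
  where
  open ≡-Reasoning
  open PrimePowers using (prodPow; product-allFin≡prodPow)
  open CountingPrimePowers p p-prime p-injective (Vec.tabulate a) using (count)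
  open OrderedFactorisationCount p p-prime p-injective (Vec.tabulate a) using (count≡Δτ)
  open OrderedFactorisations using (τ)
  open ForwardDifferences using (Δ)
  open CountingSeries j k a
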